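{- Let $r\ge2$, $k\ge1$, and let $F_1,\ldots,F_k$ be color-critical graphs with $\chi(F_i)=r+1$ for each $i$. Let $G_0$ be any graph obtained from $T_{n,r}$ by adding $k-1$ edges $e_1,\ldots,e_{k-1}$. Then $G_0$ is $\mathbb{G}(F_1,\ldots,F_k)$-free.
   Context: All graphs are finite and simple. A graph $H$ is color-critical if there is an edge $e\in E(H)$ with $\chi(H-e)<\chi(H)$. $\mathbb{G}(F_1,\ldots,F_k)$ denotes the family of graphs consisting of $k$ pairwise edge-disjoint copies of $F_1,\ldots,F_k$; a graph is $\mathbb{G}(F_1,\ldots,F_k)$-free if it contains no member of this family as a subgraph. $T_{n,r}$ is the $r$-partite Turán graph on $n$ vertices. -}

module Defs where

open import Level using (0ℓ)
open import Data.Nat using (ℕ; suc; _<_; ∣_-_∣)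
open import Data.Nat.Divisibility using (_∣_; _∣?_; _∣0)
open import Data.Nat.Properties using (∣-∣-comm; ∣n-n∣≡0)
open import Data.Fin using (Fin; toℕ)
open import Data.Fin.Properties using (_≟_; any?)
open import Data.Product using (Σ; _×_; _,_; proj₁; proj₂)
open import Data.Product.Properties using ()
open import Data.Sum using (_⊎_; inj₁; inj₂)
open import Relation.Nullary using (¬_; Dec; yes; no)
open import Relation.Nullary.Decidable using (_×-dec_; _⊎-dec_; ¬?)
open import Relation.Binary.PropositionalEquality using (_≡_; _≢_; refl; subst; sym; trans)

record Graph : Set₁ where
  field
    V      : ℕ
    Adj    : Fin V → Fin V → Set
    dec    : ∀ u v → Dec (Adj u v)
    adjSym : ∀ {u v} → Adj u v → Adj v u
    irrefl : ∀ {u} → ¬ Adj u u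
open Graph public

SameEdge : ∀ {n} → Fin n × Fin n → Fin n × Fin n → Set
SameEdge (a , b) (c , d) = (a ≡ c × b ≡ d) ⊎ (a ≡ d × b ≡ c)

sameEdge? : ∀ {n} (p q : Fin n × Fin n) → Dec (SameEdge p q)
sameEdge? (a , b) (c , d) = ((a ≟ c) ×-dec (b ≟ d)) ⊎-dec ((a ≟ d) ×-dec (b ≟ c))

Colorable : Graph → ℕ → Set
Colorable G c = Σ (Fin (V G) → Fin c) λ f → ∀ u v → Adj G u v → f u ≢ f v

ChromaticNumber : Graph → ℕ → Set
ChromaticNumber G c = Colorable G c × (∀ c' → c' < c → ¬ Colorable G c')

deleteEdge : (G : Graph) → Fin (V G) → Fin (V G) → Graph
deleteEdge G a b = record
  { V = V G
  ; Adj = λ u v → Adj G u v × ¬ SameEdge (u , v) (a , b)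
  ; dec = λ u v → dec G u v ×-dec ¬? (sameEdge? (u , v) (a , b))
  ; adjSym = λ { (h , ns) → adjSym G h , λ s → ns (flip s) }
  ; irrefl = λ { (h , _) → irrefl G h }
  }
  where
  flip : ∀ {u v} → SameEdge (v , u) (a , b) → SameEdge (u , v) (a , b)
  flip (inj₁ (p , q)) = inj₂ (q , p)
  flip (inj₂ (p , q)) = inj₁ (q , p)

ColorCritical : Graph → Set
ColorCritical H =
  Σ (Fin (V H)) λ a → Σ (Fin (V H)) λ b → Adj H a b ×
  Σ ℕ λ c → Σ ℕ λ m →
    ChromaticNumber H c × ChromaticNumber (deleteEdge H a b) m × m < c

-- Turán graph T_{n,r}: vertex i lies in part (i mod r); parts have sizes
-- ⌊n/r⌋ or ⌈n/r⌉; two vertices are adjacent iff they lie in different parts.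
TuranAdj : (n r : ℕ) → Fin n → Fin n → Set
TuranAdj n r u v = ¬ (r ∣ ∣ toℕ u - toℕ v ∣)

AddedAdj : (n r m : ℕ) → (Fin m → Fin n × Fin n) → Fin n → Fin n → Set
AddedAdj n r m e u v = TuranAdj n r u v ⊎ Σ (Fin m) λ j → SameEdge (u , v) (e j)

turanPlus : (n r m : ℕ) → (e : Fin m → Fin n × Fin n) →
            (∀ j → proj₁ (e j) ≢ proj₂ (e j)) → Graph
turanPlus n r m e ne = record
  { V = n
  ; Adj = AddedAdj n r m e
  ; dec = λ u v → ¬? (r ∣? ∣ toℕ u - toℕ v ∣) ⊎-dec any? (λ j → sameEdge? (u , v) (e j))
  ; adjSym = λ { {u} {v} (inj₁ t) → inj₁ (λ d → t (subst (r ∣_) (∣-∣-comm (toℕ v) (toℕ u)) d))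
               ; (inj₂ (j , inj₁ (p , q))) → inj₂ (j , inj₂ (q , p))
               ; (inj₂ (j , inj₂ (p , q))) → inj₂ (j , inj₁ (q , p)) }
  ; irrefl = λ { {u} (inj₁ t) → t (subst (r ∣_) (sym (∣n-n∣≡0 (toℕ u))) (r ∣0))
               ; (inj₂ (j , inj₁ (p , q))) → ne j (trans (sym p) q)
               ; (inj₂ (j , inj₂ (p , q))) → ne j (trans (sym q) p) }
  }

IsCopy : (F G : Graph) → (Fin (V F) → Fin (V G)) → Set
IsCopy F G φ = (∀ x y → φ x ≡ φ y → x ≡ y) × (∀ x y → Adj F x y → Adj G (φ x) (φ y))

-- G contains a member of 𝔾(F_1,…,F_k), i.e. k pairwise edge-disjoint copies
-- of F_1,…,F_k.
ContainsFamily : (G : Graph) → (k : ℕ) → (F : Fin k → Graph) → Set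
ContainsFamily G k F =
  Σ ((i : Fin k) → Fin (V (F i)) → Fin (V G)) λ φ →
    (∀ i → IsCopy (F i) G (φ i)) ×
    (∀ i j → i ≢ j → ∀ x y z w → Adj (F i) x y → Adj (F j) z w →
       ¬ SameEdge (φ i x , φ i y) (φ j z , φ j w))

Free : (G : Graph) → (k : ℕ) → (F : Fin k → Graph) → Set
Free G k F = ¬ ContainsFamily G k F

-- Colouring each vertex of T_{n,r} by its residue mod r is proper, so a graph
-- with χ > r cannot embed in T_{n,r}: every copy of F_i in G₀ must use one of
-- the k − 1 added edges. By pigeonhole two of the k copies use the same added
-- edge, so they are not edge-disjoint.
module Submission where

open import Defs
open import Data.Nat using (ℕ; suc; _≤_; _∸_; _+_; _*_; ∣_-_∣; NonZero; _%_; _/_; z<s)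
open import Data.Nat.Properties using (∣m+n-m+o∣≡∣n-o∣; *-distribʳ-∣-∣; n<1+n; ∸-monoʳ-<)
open import Data.Nat.DivMod using (m≡m%n+[m/n]*n; m%n<n)
open import Data.Nat.Divisibility using (_∣_; divides; _∣?_)
open import Data.Fin using (Fin; toℕ; fromℕ<)
open import Data.Fin.Properties using (toℕ-fromℕ<; any?; pigeonhole; <⇒≢)
open import Data.Product using (Σ; _×_; _,_; proj₁; proj₂)
open import Data.Sum using (inj₁; inj₂)
open import Data.Empty using (⊥; ⊥-elim)
open import Relation.Nullary using (¬_; yes; no)
open import Relation.Nullary.Decidable using (_×-dec_)
open import Relation.Binary.PropositionalEquality
  using (_≡_; _≢_; refl; sym; cong; cong₂; subst; module ≡-Reasoning)

SameEdge-sym : ∀ {n} {p q : Fin n × Fin n} → SameEdge p q → SameEdge q p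
SameEdge-sym (inj₁ (refl , refl)) = inj₁ (refl , refl)
SameEdge-sym (inj₂ (refl , refl)) = inj₂ (refl , refl)

SameEdge-trans : ∀ {n} {p q s : Fin n × Fin n} → SameEdge p q → SameEdge q s → SameEdge p s
SameEdge-trans (inj₁ (refl , refl)) q~s                  = q~s
SameEdge-trans (inj₂ (refl , refl)) (inj₁ (refl , refl)) = inj₂ (refl , refl)
SameEdge-trans (inj₂ (refl , refl)) (inj₂ (refl , refl)) = inj₁ (refl , refl)

%-cong⇒∣∣-∣ : ∀ m o n .{{_ : NonZero n}} → m % n ≡ o % n → n ∣ ∣ m - o ∣
%-cong⇒∣∣-∣ m o n m%n≡o%n = divides ∣ m / n - o / n ∣ (begin
  ∣ m - o ∣                                 ≡⟨ cong₂ ∣_-_∣ (m≡m%n+[m/n]*n m n) (m≡m%n+[m/n]*n o n) ⟩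
  ∣ m % n + m / n * n - o % n + o / n * n ∣ ≡⟨ cong (λ c → ∣ m % n + m / n * n - c + o / n * n ∣) (sym m%n≡o%n) ⟩
  ∣ m % n + m / n * n - m % n + o / n * n ∣ ≡⟨ ∣m+n-m+o∣≡∣n-o∣ (m % n) (m / n * n) (o / n * n) ⟩
  ∣ m / n * n - o / n * n ∣                 ≡⟨ *-distribʳ-∣-∣ n (m / n) (o / n) ⟨
  ∣ m / n - o / n ∣ * n                     ∎)
  where open ≡-Reasoning

turanColour : ∀ {n} r .{{_ : NonZero r}} → Fin n → Fin r
turanColour r u = fromℕ< (m%n<n (toℕ u) r)

turanColour-proper : ∀ {n} r .{{_ : NonZero r}} {u v : Fin n} →
  TuranAdj n r u v → turanColour r u ≢ turanColour r v
turanColour-proper r {u} {v} u~v same = u~v (%-cong⇒∣∣-∣ (toℕ u) (toℕ v) r (begin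
  toℕ u % r                 ≡⟨ toℕ-fromℕ< (m%n<n (toℕ u) r) ⟨
  toℕ (turanColour r u)     ≡⟨ cong toℕ same ⟩
  toℕ (turanColour r v)     ≡⟨ toℕ-fromℕ< (m%n<n (toℕ v) r) ⟩
  toℕ v % r                 ∎))
  where open ≡-Reasoning

UsesEdge : (F : Graph) {n : ℕ} → (Fin (V F) → Fin n) → Fin n × Fin n → Set
UsesEdge F φ p = Σ (Fin (V F)) λ x → Σ (Fin (V F)) λ y → Adj F x y × SameEdge (φ x , φ y) p

homomorphism-uses-addedEdge : ∀ (F : Graph) n r .{{_ : NonZero r}} m (e : Fin m → Fin n × Fin n)
  (φ : Fin (V F) → Fin n) → (∀ x y → Adj F x y → AddedAdj n r m e (φ x) (φ y)) →
  ¬ Colorable F r → Σ (Fin m) λ j → UsesEdge F φ (e j)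
homomorphism-uses-addedEdge F n r m e φ hom ¬col
  with any? (λ x → any? λ y → dec F x y ×-dec (r ∣? ∣ toℕ (φ x) - toℕ (φ y) ∣))
... | yes (x , y , x~y , r∣) with hom x y x~y
...   | inj₁ turan        = ⊥-elim (turan r∣)
...   | inj₂ (j , added)  = j , x , y , x~y , added
homomorphism-uses-addedEdge F n r m e φ hom ¬col | no noneDivisible =
  ⊥-elim (¬col ((λ x → turanColour r (φ x)) , λ x y x~y → turanColour-proper r (turanEdge x y x~y)))
  where
  turanEdge : ∀ x y → Adj F x y → TuranAdj n r (φ x) (φ y)
  turanEdge x y x~y r∣ = noneDivisible (x , y , x~y , r∣)

lemma3p2 : (r k n : ℕ) → 2 ≤ r → 1 ≤ k →
    (F : Fin k → Graph) →
    (∀ i → ColorCritical (F i)) →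
    (∀ i → ChromaticNumber (F i) (suc r)) →
    (e : Fin (k ∸ 1) → Fin n × Fin n) →
    (ne : ∀ j → proj₁ (e j) ≢ proj₂ (e j)) →
    (∀ j → ¬ TuranAdj n r (proj₁ (e j)) (proj₂ (e j))) →
    (∀ j j′ → j ≢ j′ → ¬ SameEdge (e j) (e j′)) →
    Free (turanPlus n r (k ∸ 1) e ne) k F
lemma3p2 (suc r′) k n _ k≥1 F _ χF e ne _ _ (φ , copy , disjoint) = twoCopiesShareAnEdge
  where
  r = suc r′
  used : ∀ i → Σ (Fin (k ∸ 1)) λ l → UsesEdge (F i) (φ i) (e l)
  used i = homomorphism-uses-addedEdge (F i) n r (k ∸ 1) e (φ i) (proj₂ (copy i))
             (proj₂ (χF i) r (n<1+n r))
  twoCopiesShareAnEdge : ⊥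
  twoCopiesShareAnEdge
    with i , j , i<j , sameAdded ← pigeonhole (∸-monoʳ-< z<s k≥1) (λ i → proj₁ (used i))
    with _ , (x , y , x~y , xy~eᵢ) ← used i | _ , (z , w , z~w , zw~eⱼ) ← used j
    = disjoint i j (<⇒≢ i<j) x y z w x~y z~w
        (SameEdge-trans xy~eᵢ (SameEdge-sym (subst (λ l → SameEdge _ (e l)) (sym sameAdded) zw~eⱼ)))
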